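{- For every integer $k\geq 1$, $b_2(K_{2k+1})\geq k+1$.
   Context: $K_n$ is the complete graph on $n$ vertices. For a finite simple graph $G=(V,E)$, a biclique on a subset of $V$ is given by two disjoint sets $X,Y\subseteq V$; its edges are all pairs $\{x,y\}$ with $x\in X$, $y\in Y$. An odd cover of $G$ is a collection of bicliques on subsets of $V$ such that every pair of vertices adjacent in $G$ is an edge of an odd number of the bicliques, and every pair of distinct non-adjacent vertices is an edge of an even number of the bicliques. $b_2(G)$ denotes the minimum cardinality of an odd cover of $G$. -}

module Defs where

open import Data.Nat using (ℕ; zero; suc)
open import Data.Bool using (Bool; true; false; _∧_; _∨_; not; _xor_)
open import Data.Fin using (Fin)
open import Data.List using (List; []; _∷_)
open import Data.Product using (_×_)
open import Relation.Binary.PropositionalEquality using (_≡_; _≢_)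
open import Relation.Nullary using (¬_)

record Graph (n : ℕ) : Set where
  field
    adj   : Fin n → Fin n → Bool
    sym   : ∀ u v → adj u v ≡ adj v u
    irrefl : ∀ u → adj u u ≡ false

open Graph public

complete : (n : ℕ) → Graph n
complete n = record { adj = adjK ; sym = symK ; irrefl = irrK }
  where
  open import Data.Fin using (_≟_)
  open import Relation.Nullary using (yes; no)
  open import Relation.Binary.PropositionalEquality using (refl)
  import Relation.Binary.PropositionalEquality as Eq
  adjK : Fin n → Fin n → Bool
  adjK u v with u ≟ v
  ... | yes _ = false
  ... | no _ = true
  symK : ∀ u v → adjK u v ≡ adjK v u
  symK u v with u ≟ v | v ≟ u
  ... | yes _ | yes _ = refl
  ... | no _ | no _ = refl
  ... | yes p | no q = Data.Empty.⊥-elim (q (Eq.sym p))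
    where import Data.Empty
  ... | no p | yes q = Data.Empty.⊥-elim (p (Eq.sym q))
    where import Data.Empty
  irrK : ∀ u → adjK u u ≡ false
  irrK u with u ≟ u
  ... | yes _ = refl
  ... | no p = Data.Empty.⊥-elim (p refl)
    where import Data.Empty

record Biclique (n : ℕ) : Set where
  field
    X Y      : Fin n → Bool
    disjoint : ∀ v → X v ∧ Y v ≡ false

open Biclique public

bicliqueEdge : ∀ {n} → Biclique n → Fin n → Fin n → Bool
bicliqueEdge B u v = (X B u ∧ Y B v) ∨ (X B v ∧ Y B u)

edgeParity : ∀ {n} → List (Biclique n) → Fin n → Fin n → Bool
edgeParity []       u v = false
edgeParity (B ∷ Bs) u v = bicliqueEdge B u v xor edgeParity Bs u v

IsOddCover : ∀ {n} → Graph n → List (Biclique n) → Set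
IsOddCover G Bs = ∀ u v → u ≢ v → edgeParity Bs u v ≡ adj G u v

-- Over GF(2), the bicliques (X, Y) of an odd cover of K_n express the
-- all-ones-off-the-diagonal matrix as ∑ (X Yᵀ + Y Xᵀ).  If there are m
-- bicliques with 2m < n, Gaussian elimination gives a nonzero S supported
-- away from vertex 0 that is orthogonal to X₁ and to X_B, Y_B for every other
-- B (2m - 1 conditions on n - 1 coordinates); testing the
-- cover against S shows S = σ + c X₁ pointwise with σ = ∑ S and c = S·Y₁,
-- and disjointness of X₁ and Y₁ then forces vertex 0 into X₁.  By the
-- X/Y symmetry vertex 0 also lies in Y₁, which is impossible.
module Submission where

open import Defs
open import Data.Nat using (ℕ; _+_; _*_; _≤_; _≥_)
open import Data.List using (List; length)

open import Algebra.Bundles using (CommutativeRing)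
open import Data.Bool using (Bool; true; false; _∧_; _∨_; _xor_)
open import Data.Bool.Properties
  using ( xor-∧-commutativeRing; ∧-assoc; ∧-comm; ∨-comm; ∧-zeroʳ; ∧-identityʳ
        ; ∨-identityʳ; ∧-distribˡ-xor; xor-assoc; xor-comm; xor-same; xor-identityʳ
        ; ¬-not; not-¬)
open import Data.Empty using (⊥; ⊥-elim)
open import Data.Fin using (Fin; zero; suc; punchIn; _≟_)
import Data.Bool as Bool
open import Data.Fin.Properties using (punchInᵢ≢i)
open import Data.List using ([]; _∷_; map)
open import Data.List.Properties using (length-map; length-removeAt′)
open import Data.List.Relation.Unary.All as All using (All; []; _∷_)
open import Data.List.Relation.Unary.All.Properties using (¬Any⇒All¬; map⁻; ─⁻)
open import Data.List.Relation.Unary.Any as Any using (any?; _─_)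
open import Data.List.Relation.Unary.Any.Properties using (lookup-result)
open import Data.Nat as ℕ using (_<_; s≤s)
open import Data.Nat.Properties
  using (≤-trans; <-≤-trans; m≤m+n; m<m+n; *-suc; *-monoʳ-≤; *-cancelˡ-<; ≮⇒≥; +-comm)
open import Data.Product using (∃; _×_; _,_)
open import Data.Vec.Functional as Vec using (Vector; tail; removeAt)
open import Function using (case_of_)
open import Relation.Binary.PropositionalEquality as ≡
  using (_≡_; _≢_; refl; trans; cong; cong₂; subst; module ≡-Reasoning)
open import Relation.Nullary using (yes; no)

open CommutativeRing xor-∧-commutativeRing using (semiring)
open import Algebra.Properties.Semiring.Sum semiring
  using (sum; sum-cong-≗; sum-replicate-zero; sum-remove; ∑-distrib-+; *-distribʳ-sum)

open ≡-Reasoning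

infix 7 _·_

_·_ : ∀ {n} → Vector Bool n → Vector Bool n → Bool
u · v = sum (λ t → u t ∧ v t)

·-zeroʳ : ∀ {n} (u : Vector Bool n) → u · (λ _ → false) ≡ false
·-zeroʳ {n} u = trans (sum-cong-≗ (λ t → ∧-zeroʳ (u t))) (sum-replicate-zero n)

·-congʳ : ∀ {n} (u : Vector Bool n) {v w : Vector Bool n} → (∀ t → v t ≡ w t) → u · v ≡ u · w
·-congʳ u v≗w = sum-cong-≗ (λ t → cong (u t ∧_) (v≗w t))

·-distribʳ-xor : ∀ {n} (u v w : Vector Bool n) → u · (λ t → v t xor w t) ≡ (u · v) xor (u · w)
·-distribʳ-xor u v w =
  trans (sum-cong-≗ (λ t → ∧-distribˡ-xor (u t) (v t) (w t)))
        (∑-distrib-+ (λ t → u t ∧ v t) (λ t → u t ∧ w t))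

·-∧ʳ : ∀ {n} (u v : Vector Bool n) c → u · (λ t → v t ∧ c) ≡ (u · v) ∧ c
·-∧ʳ u v c =
  trans (sum-cong-≗ (λ t → ≡.sym (∧-assoc (u t) (v t) c)))
        (≡.sym (*-distribʳ-sum c (λ t → u t ∧ v t)))

xor-cancelʳ : ∀ x y → (x xor y) xor x ≡ y
xor-cancelʳ x y = begin
  (x xor y) xor x  ≡⟨ cong (_xor x) (xor-comm x y) ⟩
  (y xor x) xor x  ≡⟨ xor-assoc y x x ⟩
  y xor (x xor x)  ≡⟨ cong (y xor_) (xor-same x) ⟩
  y xor false      ≡⟨ xor-identityʳ y ⟩
  y                ∎

·-allBut : ∀ {n} (u a : Vector Bool n) v → a v ≡ false → (∀ t → t ≢ v → a t ≡ true) →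
  u · a ≡ sum u xor u v
·-allBut {ℕ.suc n} u a v av≡false a≡true = begin
  u · a                                               ≡⟨ sum-remove {i = v} (λ t → u t ∧ a t) ⟩
  (u v ∧ a v) xor sum (removeAt (λ t → u t ∧ a t) v)  ≡⟨ cong₂ _xor_ uv∧av≡false rest ⟩
  sum (removeAt u v)                                  ≡⟨ xor-cancelʳ (u v) _ ⟨
  (u v xor sum (removeAt u v)) xor u v                ≡⟨ cong (_xor u v) (sum-remove u) ⟨
  sum u xor u v                                       ∎
  where
  uv∧av≡false : u v ∧ a v ≡ false
  uv∧av≡false = trans (cong (u v ∧_) av≡false) (∧-zeroʳ (u v))
  rest : sum (removeAt (λ t → u t ∧ a t) v) ≡ sum (removeAt u v)
  rest = sum-cong-≗ λ t →
    trans (cong (u (punchIn v t) ∧_) (a≡true _ (punchInᵢ≢i v t))) (∧-identityʳ _)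

Nonzero : ∀ {n} → Vector Bool n → Set
Nonzero u = ∃ λ t → u t ≡ true

-- R with its first coordinate cleared by the pivot row P (one with P zero ≡ true).
eliminate : ∀ {n} → Vector Bool (ℕ.suc n) → Vector Bool (ℕ.suc n) → Vector Bool n
eliminate P R t = R (suc t) xor (P (suc t) ∧ R zero)

·-eliminate : ∀ {n} (μ : Vector Bool n) (P R : Vector Bool (ℕ.suc n)) →
  ((μ · tail P) Vec.∷ μ) · R ≡ μ · eliminate P R
·-eliminate μ P R = begin
  ((μ · tail P) ∧ R zero) xor (μ · tail R)
    ≡⟨ xor-comm ((μ · tail P) ∧ R zero) (μ · tail R) ⟩
  (μ · tail R) xor ((μ · tail P) ∧ R zero)
    ≡⟨ cong ((μ · tail R) xor_) (·-∧ʳ μ (tail P) (R zero)) ⟨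
  (μ · tail R) xor (μ · (λ t → P (suc t) ∧ R zero))
    ≡⟨ ·-distribʳ-xor μ (tail R) (λ t → P (suc t) ∧ R zero) ⟨
  μ · eliminate P R ∎

nonzero-orthogonal : ∀ {n} (Rs : List (Vector Bool n)) → length Rs < n →
  ∃ λ S → Nonzero S × All (λ R → S · R ≡ false) Rs
nonzero-orthogonal {ℕ.suc n} Rs len<n with any? (λ R → R zero Bool.≟ true) Rs
... | no noPivot =
  e₀ , (zero , refl) ,
  All.map (λ {R} → e₀-orthogonal {R}) (¬Any⇒All¬ {P = λ R → R zero ≡ true} Rs noPivot)
  where
  e₀ : Vector Bool (ℕ.suc n)
  e₀ = true Vec.∷ (λ _ → false)
  e₀-orthogonal : ∀ {R} → R zero ≢ true → e₀ · R ≡ false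
  e₀-orthogonal R₀≢true = cong₂ _xor_ (¬-not R₀≢true) (sum-replicate-zero n)
... | yes pivot
  with nonzero-orthogonal (map (eliminate (Any.lookup pivot)) (Rs ─ pivot)) fewer-equations
  where
  fewer-equations : length (map (eliminate (Any.lookup pivot)) (Rs ─ pivot)) < n
  fewer-equations = subst (_< n) (≡.sym (length-map (eliminate (Any.lookup pivot)) (Rs ─ pivot)))
    (ℕ.s<s⁻¹ (subst (_< ℕ.suc n) (length-removeAt′ Rs (Any.index pivot)) len<n))
...   | μ , (t , μt≡true) , μ⊥Rs′ =
  S , (suc t , μt≡true) ,
  ─⁻ pivot S·P≡false (All.map (λ {R} → S⊥R {R}) (map⁻ {f = eliminate P} μ⊥Rs′))
  where
  P = Any.lookup pivot
  S = (μ · tail P) Vec.∷ μ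
  S·P≡false : S · P ≡ false
  S·P≡false = begin
    ((μ · tail P) ∧ P zero) xor (μ · tail P)
      ≡⟨ cong (λ b → ((μ · tail P) ∧ b) xor (μ · tail P)) (lookup-result pivot) ⟩
    ((μ · tail P) ∧ true) xor (μ · tail P)
      ≡⟨ cong (_xor (μ · tail P)) (∧-identityʳ (μ · tail P)) ⟩
    (μ · tail P) xor (μ · tail P)
      ≡⟨ xor-same (μ · tail P) ⟩
    false ∎
  S⊥R : ∀ {R} → μ · eliminate P R ≡ false → S · R ≡ false
  S⊥R {R} = trans (·-eliminate μ P R)

bicliqueEdge-xor : ∀ {n} (B : Biclique n) u v →
  bicliqueEdge B u v ≡ (X B u ∧ Y B v) xor (Y B u ∧ X B v)
bicliqueEdge-xor B u v with X B u | Y B u | disjoint B u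
... | true  | true  | ()
... | true  | false | _ =
  trans (cong (Y B v ∨_) (∧-zeroʳ (X B v)))
        (trans (∨-identityʳ (Y B v)) (≡.sym (xor-identityʳ (Y B v))))
... | false | true  | _ = ∧-identityʳ (X B v)
... | false | false | _ = ∧-zeroʳ (X B v)

·-bicliqueEdge : ∀ {n} (S : Vector Bool n) (B : Biclique n) v →
  S · (λ u → bicliqueEdge B u v) ≡ ((S · X B) ∧ Y B v) xor ((S · Y B) ∧ X B v)
·-bicliqueEdge S B v = begin
  S · (λ u → bicliqueEdge B u v)
    ≡⟨ ·-congʳ S (λ u → bicliqueEdge-xor B u v) ⟩
  S · (λ u → (X B u ∧ Y B v) xor (Y B u ∧ X B v))
    ≡⟨ ·-distribʳ-xor S (λ u → X B u ∧ Y B v) (λ u → Y B u ∧ X B v) ⟩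
  S · (λ u → X B u ∧ Y B v) xor S · (λ u → Y B u ∧ X B v)
    ≡⟨ cong₂ _xor_ (·-∧ʳ S (X B) (Y B v)) (·-∧ʳ S (Y B) (X B v)) ⟩
  ((S · X B) ∧ Y B v) xor ((S · Y B) ∧ X B v) ∎

Orthogonal : ∀ {n} → Vector Bool n → Biclique n → Set
Orthogonal S B = S · X B ≡ false × S · Y B ≡ false

·-edgeParity-∷ : ∀ {n} (S : Vector Bool n) B Bs v →
  S · (λ u → edgeParity (B ∷ Bs) u v)
    ≡ (((S · X B) ∧ Y B v) xor ((S · Y B) ∧ X B v)) xor S · (λ u → edgeParity Bs u v)
·-edgeParity-∷ S B Bs v =
  trans (·-distribʳ-xor S (λ u → bicliqueEdge B u v) (λ u → edgeParity Bs u v))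
        (cong (_xor S · (λ u → edgeParity Bs u v)) (·-bicliqueEdge S B v))

·-edgeParity-orthogonal : ∀ {n} (S : Vector Bool n) {Bs} → All (Orthogonal S) Bs →
  ∀ v → S · (λ u → edgeParity Bs u v) ≡ false
·-edgeParity-orthogonal S []                              v = ·-zeroʳ S
·-edgeParity-orthogonal S {B ∷ Bs} ((S⊥X , S⊥Y) ∷ S⊥Bs) v = begin
  S · (λ u → edgeParity (B ∷ Bs) u v)
    ≡⟨ ·-edgeParity-∷ S B Bs v ⟩
  (((S · X B) ∧ Y B v) xor ((S · Y B) ∧ X B v)) xor S · (λ u → edgeParity Bs u v)
    ≡⟨ cong₂ (λ x y → ((x ∧ Y B v) xor (y ∧ X B v)) xor S · (λ u → edgeParity Bs u v))
             S⊥X S⊥Y ⟩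
  S · (λ u → edgeParity Bs u v)
    ≡⟨ ·-edgeParity-orthogonal S S⊥Bs v ⟩
  false ∎

·-edgeParity : ∀ {n} (S : Vector Bool n) (B : Biclique n) {Bs} → S · X B ≡ false →
  All (Orthogonal S) Bs → ∀ v → S · (λ u → edgeParity (B ∷ Bs) u v) ≡ (S · Y B) ∧ X B v
·-edgeParity S B {Bs} S⊥X S⊥Bs v = begin
  S · (λ u → edgeParity (B ∷ Bs) u v)
    ≡⟨ ·-edgeParity-∷ S B Bs v ⟩
  (((S · X B) ∧ Y B v) xor ((S · Y B) ∧ X B v)) xor S · (λ u → edgeParity Bs u v)
    ≡⟨ cong₂ (λ x y → ((x ∧ Y B v) xor ((S · Y B) ∧ X B v)) xor y)
             S⊥X (·-edgeParity-orthogonal S S⊥Bs v) ⟩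
  ((S · Y B) ∧ X B v) xor false
    ≡⟨ xor-identityʳ ((S · Y B) ∧ X B v) ⟩
  (S · Y B) ∧ X B v ∎

edgeParity-diagonal : ∀ {n} (Bs : List (Biclique n)) u → edgeParity Bs u u ≡ false
edgeParity-diagonal []       u = refl
edgeParity-diagonal (B ∷ Bs) u =
  cong₂ _xor_ (cong (λ b → b ∨ b) (disjoint B u)) (edgeParity-diagonal Bs u)

adj-complete : ∀ {n} {u v : Fin n} → u ≢ v → adj (complete n) u v ≡ true
adj-complete {u = u} {v} u≢v with u ≟ v
... | yes u≡v = ⊥-elim (u≢v u≡v)
... | no _    = refl

·-oddCover-complete : ∀ {n} {Bs : List (Biclique n)} → IsOddCover (complete n) Bs →
  (S : Vector Bool n) → ∀ v → S · (λ u → edgeParity Bs u v) ≡ sum S xor S v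
·-oddCover-complete {Bs = Bs} cover S v =
  ·-allBut S (λ u → edgeParity Bs u v) v (edgeParity-diagonal Bs v)
    (λ u u≢v → trans (cover u v u≢v) (adj-complete u≢v))

vanishing-coordinate-in-x : ∀ {n} (S x y : Vector Bool n) → (∀ t → x t ∧ y t ≡ false) →
  Nonzero S → (∀ t → sum S xor S t ≡ (S · y) ∧ x t) → ∀ v → S v ≡ false → x v ≡ true
vanishing-coordinate-in-x {n} S x y x∩y≡∅ (t , St≡true) profile v Sv≡false with x v in xv≡
... | true  = refl
... | false = ⊥-elim (not-¬ St≡true (trans (S≡cx t) (cong (_∧ x t) c≡false)))
  where
  σ≡false : sum S ≡ false
  σ≡false = begin
    sum S             ≡⟨ xor-identityʳ (sum S) ⟨
    sum S xor false   ≡⟨ cong (sum S xor_) Sv≡false ⟨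
    sum S xor S v     ≡⟨ profile v ⟩
    (S · y) ∧ x v     ≡⟨ cong ((S · y) ∧_) xv≡ ⟩
    (S · y) ∧ false   ≡⟨ ∧-zeroʳ (S · y) ⟩
    false             ∎
  S≡cx : ∀ t → S t ≡ (S · y) ∧ x t
  S≡cx t = trans (cong (_xor S t) (≡.sym σ≡false)) (profile t)
  c≡false : S · y ≡ false
  c≡false = trans (sum-cong-≗ Sy≡false) (sum-replicate-zero n)
    where
    Sy≡false : ∀ t → S t ∧ y t ≡ false
    Sy≡false t = begin
      S t ∧ y t               ≡⟨ cong (_∧ y t) (S≡cx t) ⟩
      ((S · y) ∧ x t) ∧ y t   ≡⟨ ∧-assoc (S · y) (x t) (y t) ⟩
      (S · y) ∧ (x t ∧ y t)   ≡⟨ cong ((S · y) ∧_) (x∩y≡∅ t) ⟩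
      (S · y) ∧ false         ≡⟨ ∧-zeroʳ (S · y) ⟩
      false                   ∎

sideRows : ∀ {N} → List (Biclique (ℕ.suc N)) → List (Vector Bool N)
sideRows []       = []
sideRows (B ∷ Bs) = tail (X B) ∷ tail (Y B) ∷ sideRows Bs

length-sideRows : ∀ {N} (Bs : List (Biclique (ℕ.suc N))) → length (sideRows Bs) ≡ 2 * length Bs
length-sideRows []       = refl
length-sideRows (B ∷ Bs) = trans (cong (2 +_) (length-sideRows Bs)) (≡.sym (*-suc 2 (length Bs)))

orthogonal-sideRows : ∀ {N} (μ : Vector Bool N) Bs → All (λ R → μ · R ≡ false) (sideRows Bs) →
  All (Orthogonal (false Vec.∷ μ)) Bs
orthogonal-sideRows μ []       []                   = []
orthogonal-sideRows μ (B ∷ Bs) (μ⊥X ∷ μ⊥Y ∷ μ⊥Rs) = (μ⊥X , μ⊥Y) ∷ orthogonal-sideRows μ Bs μ⊥Rs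

zero∈X-of-first : ∀ {N} (B : Biclique (ℕ.suc N)) Bs →
  IsOddCover (complete (ℕ.suc N)) (B ∷ Bs) →
  2 * length (B ∷ Bs) ≤ N → X B zero ≡ true
zero∈X-of-first {N} B Bs cover 2m≤N
  with nonzero-orthogonal (tail (X B) ∷ sideRows Bs) fewer-equations
  where
  fewer-equations : length (tail (X B) ∷ sideRows Bs) < N
  fewer-equations =
    subst (_≤ N) (trans (*-suc 2 (length Bs)) (cong (2 +_) (≡.sym (length-sideRows Bs)))) 2m≤N
... | μ , (t , μt≡true) , μ⊥X ∷ μ⊥Rs =
  vanishing-coordinate-in-x S (X B) (Y B) (disjoint B) (suc t , μt≡true) profile zero refl
  where
  S : Vector Bool (ℕ.suc N)
  S = false Vec.∷ μ
  profile : ∀ v → sum S xor S v ≡ (S · Y B) ∧ X B v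
  profile v = trans (≡.sym (·-oddCover-complete {Bs = B ∷ Bs} cover S v))
    (·-edgeParity S B μ⊥X (orthogonal-sideRows μ Bs μ⊥Rs) v)

swap : ∀ {n} → Biclique n → Biclique n
swap B = record
  { X = Y B ; Y = X B ; disjoint = λ v → trans (∧-comm (Y B v) (X B v)) (disjoint B v) }

edgeParity-swap : ∀ {n} (Bs : List (Biclique n)) u v →
  edgeParity (map swap Bs) u v ≡ edgeParity Bs u v
edgeParity-swap []       u v = refl
edgeParity-swap (B ∷ Bs) u v = cong₂ _xor_ swap-edge (edgeParity-swap Bs u v)
  where
  swap-edge : bicliqueEdge (swap B) u v ≡ bicliqueEdge B u v
  swap-edge = trans (∨-comm (Y B u ∧ X B v) (Y B v ∧ X B u))
    (cong₂ _∨_ (∧-comm (Y B v) (X B u)) (∧-comm (Y B u) (X B v)))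

oddCover-swap : ∀ {n} {G : Graph n} {Bs} → IsOddCover G Bs → IsOddCover G (map swap Bs)
oddCover-swap {Bs = Bs} cover u v u≢v = trans (edgeParity-swap Bs u v) (cover u v u≢v)

length-oddCover-complete : ∀ {n} → 2 ≤ n → (Bs : List (Biclique n)) →
  IsOddCover (complete n) Bs → n ≤ 2 * length Bs
length-oddCover-complete 2≤n Bs cover = ≮⇒≥ (no-small-cover 2≤n Bs cover)
  where
  no-small-cover : ∀ {n} → 2 ≤ n → (Bs : List (Biclique n)) → IsOddCover (complete n) Bs →
    2 * length Bs < n → ⊥
  no-small-cover {n} (s≤s (s≤s _)) [] cover _ =
    case trans (cover zero (suc zero) (λ ())) (adj-complete {n} {zero} {suc zero} (λ ())) of λ ()
  no-small-cover {ℕ.suc N} _ (B ∷ Bs) cover 2m<n =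
    case trans (cong₂ _∧_ (≡.sym zero∈X) (≡.sym zero∈Y)) (disjoint B zero) of λ ()
    where
    zero∈X : X B zero ≡ true
    zero∈X = zero∈X-of-first B Bs cover (ℕ.s≤s⁻¹ 2m<n)
    zero∈Y : Y B zero ≡ true
    zero∈Y = zero∈X-of-first (swap B) (map swap Bs)
      (oddCover-swap {G = complete (ℕ.suc N)} {B ∷ Bs} cover)
      (subst (λ m → 2 * m ≤ N) (≡.sym (length-map swap (B ∷ Bs))) (ℕ.s≤s⁻¹ 2m<n))

lemma6p2 : (k : ℕ) → k ≥ 1 → (Bs : List (Biclique (2 * k + 1))) →
    IsOddCover (complete (2 * k + 1)) Bs → k + 1 ≤ length Bs
lemma6p2 k k≥1 Bs cover = subst (_≤ length Bs) (+-comm 1 k) k<m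
  where
  2≤n : 2 ≤ 2 * k + 1
  2≤n = ≤-trans (*-monoʳ-≤ 2 k≥1) (m≤m+n (2 * k) 1)
  k<m : k < length Bs
  k<m = *-cancelˡ-< 2 k (length Bs)
    (<-≤-trans (m<m+n (2 * k) {1} ℕ.z<s) (length-oddCover-complete 2≤n Bs cover))
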